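{- Let $r\ge2$, $2\le k\le r+1$ and $n\ge1$ be integers, and let $t=k-1$. Then \[ {\rm ex}(tn,H_k^r) \geq t^r\,{\rm ex}(n,H_k^r) + \frac{1}{n}\binom{tn}{r} - \frac{1}{n}\,t^r\binom{n}{r} - \frac{1}{2}\,t^{r-1}(t-1)\binom{n-1}{r-2}. \]
   Context: $H_k^r$ is the $r$-uniform hypergraph with $r+1$ vertices and $k$ edges ($k\le r+1$); ${\rm ex}(n,H)$ is the maximum number of edges in an $r$-uniform hypergraph on $n$ vertices with no subgraph isomorphic to $H$. -}

module Defs where

open import Data.Nat using (ℕ; suc; _<_; _≤_)
open import Data.Fin using (Fin; toℕ)
open import Data.Fin.Subset using (Subset; ∣_∣) renaming (_∈_ to _∈ₛ_)
open import Data.List using (List; length)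
open import Data.List.Membership.Propositional using (_∈_)
open import Data.List.Relation.Unary.All using (All)
open import Data.List.Relation.Unary.Unique.Propositional using (Unique)
open import Data.Product using (Σ; ∃; _×_)
open import Relation.Binary.PropositionalEquality using (_≡_; _≢_)
open import Function.Bundles using (_⇔_)
open import Function.Definitions using (Injective)
open import Relation.Nullary using (¬_)

record Hypergraph (r n : ℕ) : Set where
  field
    edges   : List (Subset n)
    unique  : Unique edges
    uniform : All (λ e → ∣ e ∣ ≡ r) edges

open Hypergraph public

∥_∥ : ∀ {r n} → Hypergraph r n → ℕ
∥ G ∥ = length (edges G)

-- H_k^r: vertex set Fin (suc r); its k edges are the r-sets Fin (suc r) ∖ {i}
-- for the vertices i with toℕ i < k.
ContainsH : ∀ {r n} (k : ℕ) → Hypergraph r n → Set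
ContainsH {r} {n} k G =
  Σ (Fin (suc r) → Fin n) λ f →
    Injective _≡_ _≡_ f ×
    ((i : Fin (suc r)) → toℕ i < k →
      Σ (Subset n) λ e → e ∈ edges G ×
        ((v : Fin n) → (v ∈ₛ e) ⇔ (∃ λ j → j ≢ i × f j ≡ v)))

HFree : ∀ {r n} (k : ℕ) → Hypergraph r n → Set
HFree k G = ¬ ContainsH k G

IsEx : (r k n m : ℕ) → Set
IsEx r k n m =
  (Σ (Hypergraph r n) λ G → HFree k G × ∥ G ∥ ≡ m) ×
  ((G : Hypergraph r n) → HFree k G → ∥ G ∥ ≤ m)

{-# OPTIONS --safe #-}
module Submission where

-- Split the t·n vertices (t = k − 1) into n blocks of size t. An r-set is transversal if it
-- meets every block at most once, one-double if it meets one block exactly twice and every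
-- other block at most once, and crowded otherwise; its shadow is the set of blocks it meets.
-- From an extremal H_k^r-free G on n vertices keep the transversal r-sets whose shadow is an
-- edge of G (ex(n, H_k^r)·t^r of them) and the crowded r-sets whose vertices' block indices sum
-- to a residue c mod n; for the best c this is at least a 1/n share of all crowded r-sets.
-- The result is H_k^r-free: a copy whose vertices lie in distinct blocks projects to a copy in
-- G; two crowded edges of a copy have the same residue only if their missing vertices share a
-- block, and so a collision inside the copy forces either k vertices into one block of size
-- k − 1 or a one-double edge.
-- Counting C(tn, r) = C(n, r)·t^r + #one-double + #crowded, where
-- #one-double = t^(r−2)·C(t, 2)·n·C(n − 1, r − 2), then gives the bound.

open import Defs
open import Algebra.Bundles using (CommutativeMonoid)
open import Data.Bool using (Bool; true; false; _∧_; _∨_; not; T; T?)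
import Data.Bool as Bool
open import Data.Bool.Properties using (T-≡; T-∧; T-∨; ∧-commutativeMonoid; ∧-identityʳ; ∧-zeroʳ; ∨-identityʳ)
open import Data.Empty using (⊥; ⊥-elim)
open import Data.Fin using (Fin; zero; suc; toℕ; inject≤; combine; remQuot; quotient; remainder; _↑ˡ_; _↑ʳ_)
import Data.Fin.Properties as Fin
open import Data.Fin.Subset using (Subset; ∣_∣; inside; outside; _─_; _-_; ⁅_⁆; _⊆_; Empty; Nonempty)
  renaming (_∈_ to _∈ₛ_; _∉_ to _∉ₛ_)
open import Data.Fin.Subset.Properties
  using (p─⊥≡p; ⊆-antisym; Empty-unique; ∣⊥∣≡0; nonempty?; x∈p∧x≢y⇒x∈p-y; p─q⊆p; x∈⁅x⁆)
open import Data.List using (List; []; _∷_; length; map; filterᵇ; allFin; tabulate) renaming (_++_ to _++ₗ_)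
open import Data.List.Properties using (map-++; map-∘; length-tabulate)
open import Data.List.Membership.Propositional using (_∈_)
open import Data.List.Membership.Propositional.Properties using (∈-map⁻; ∈-allFin; ∈-filter⁻)
import Data.List.Membership.DecPropositional as DecMembership
open import Data.List.Relation.Unary.All using (All; []; _∷_)
import Data.List.Relation.Unary.All as All
open import Data.List.Relation.Unary.All.Properties using (all-filter)
open import Data.List.Relation.Unary.Unique.Propositional using (Unique; []; _∷_)
import Data.List.Relation.Unary.Unique.Propositional.Properties as Unique
open import Data.Nat using (ℕ; zero; suc; _+_; _*_; _∸_; _^_; _≤_; _<_; _≤ᵇ_; _≡ᵇ_; z≤n; s≤s; NonZero; _%_; _/_)
open import Data.Nat.Combinatorics using (_C_; nC1≡n; nCk+nC[k+1]≡[n+1]C[k+1])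
open import Data.Nat.DivMod using (_mod_; m≡m%n+[m/n]*n; [m+kn]%n≡m%n; m<n⇒m%n≡m)
open import Data.Nat.ListAction using (sum)
open import Data.Nat.ListAction.Properties using (sum-++)
open import Data.Nat.Properties
open import Data.Nat.Tactic.RingSolver using (solve-∀)
open import Data.Product using (Σ; _×_; _,_; proj₁; proj₂; ∃)
open import Data.Sum using (_⊎_; inj₁; inj₂; [_,_])
open import Data.Vec using (Vec; []; _∷_; _++_; take; drop; lookup; here; there)
open import Data.Vec.Properties using (∷-injectiveʳ; take++drop≡id; ≡-dec; []=⇒lookup; lookup⇒[]=)
open import Function using (_∘_; id)
open import Function.Bundles using (Equivalence; mk⇔; _⇔_)
open import Function.Definitions using (Injective)
open import Relation.Binary.Definitions using (DecidableEquality) renaming (Decidable to Decidable₂)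
open import Relation.Binary.PropositionalEquality hiding ([_])
open import Relation.Nullary using (¬_; ¬?; Dec; yes; no; does; _×-dec_)
open import Algebra.Properties.CommutativeSemigroup +-commutativeSemigroup
  using () renaming (interchange to [w+x]+[y+z]≡[w+y]+[x+z]; x∙yz≈y∙xz to x+[y+z]≡y+[x+z])
open import Algebra.Properties.CommutativeSemigroup (CommutativeMonoid.commutativeSemigroup ∧-commutativeMonoid)
  using () renaming (x∙yz≈y∙xz to x∧[y∧z]≡y∧[x∧z])

𝟙 : Bool → ℕ
𝟙 true = 1
𝟙 false = 0

cong₃ : ∀ {A B C D : Set} (f : A → B → C → D) {x y u v a b} → x ≡ y → u ≡ v → a ≡ b → f x u a ≡ f y v b
cong₃ f refl refl refl = refl

T-∧⁻ : ∀ x {y} → T (x ∧ y) → T x × T y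
T-∧⁻ x = Equivalence.to (T-∧ {x})

T-∧⁺ : ∀ {x y} → T x → T y → T (x ∧ y)
T-∧⁺ tx ty = Equivalence.from T-∧ (tx , ty)

T-∨⁻ : ∀ x {y} → T (x ∨ y) → T x ⊎ T y
T-∨⁻ x = Equivalence.to (T-∨ {x})

T-∨⁺ˡ : ∀ {x y} → T x → T (x ∨ y)
T-∨⁺ˡ tx = Equivalence.from T-∨ (inj₁ tx)

T-∨⁺ʳ : ∀ {x y} → T y → T (x ∨ y)
T-∨⁺ʳ {x} ty = Equivalence.from (T-∨ {x}) (inj₂ ty)

⇒does : ∀ {A : Set} (a? : Dec A) → A → T (does a?)
⇒does (yes _) _ = _
⇒does (no ¬a) a = ¬a a

does⇒ : ∀ {A : Set} (a? : Dec A) → T (does a?) → A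
does⇒ (yes a) _ = a

T-not⁻ : ∀ x → T (not x) → ¬ T x
T-not⁻ false _ ()

𝟙-∨-disjoint : ∀ x y → (T x → ¬ T y) → 𝟙 (x ∨ y) ≡ 𝟙 x + 𝟙 y
𝟙-∨-disjoint true true disjoint = ⊥-elim (disjoint _ _)
𝟙-∨-disjoint true false _ = refl
𝟙-∨-disjoint false y _ = refl

module _ {A : Set} where

  take-++ : ∀ {a b} (x : Vec A a) (y : Vec A b) → take a (x ++ y) ≡ x
  take-++ [] y = refl
  take-++ (u ∷ x) y = cong (u ∷_) (take-++ x y)

  drop-++ : ∀ {a b} (x : Vec A a) (y : Vec A b) → drop a (x ++ y) ≡ y
  drop-++ [] y = refl
  drop-++ (u ∷ x) y = drop-++ x y

  lookup-↑ˡ : ∀ a {b} (v : Vec A (a + b)) (i : Fin a) → lookup v (i ↑ˡ b) ≡ lookup (take a v) i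
  lookup-↑ˡ (suc a) (u ∷ v) zero = refl
  lookup-↑ˡ (suc a) (u ∷ v) (suc i) = lookup-↑ˡ a v i

  lookup-↑ʳ : ∀ a {b} (v : Vec A (a + b)) (j : Fin b) → lookup v (a ↑ʳ j) ≡ lookup (drop a v) j
  lookup-↑ʳ zero v j = refl
  lookup-↑ʳ (suc a) (u ∷ v) j = lookup-↑ʳ a v j

∣++∣ : ∀ {a b} (x : Subset a) (y : Subset b) → ∣ x ++ y ∣ ≡ ∣ x ∣ + ∣ y ∣
∣++∣ [] y = refl
∣++∣ (inside ∷ x) y = cong suc (∣++∣ x y)
∣++∣ (outside ∷ x) y = ∣++∣ x y

∣take∣+∣drop∣ : ∀ a {b} (v : Subset (a + b)) → ∣ v ∣ ≡ ∣ take a v ∣ + ∣ drop a v ∣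
∣take∣+∣drop∣ a v = trans (cong ∣_∣ (sym (take++drop≡id a v))) (∣++∣ (take a v) (drop a v))

x∈p─q⇒x∉q : ∀ {n} (p q : Subset n) {x} → x ∈ₛ p ─ q → x ∉ₛ q
x∈p─q⇒x∉q (inside ∷ p) (outside ∷ q) here = λ ()
x∈p─q⇒x∉q (_ ∷ p) (_ ∷ q) (there x∈p─q) (there x∈q) = x∈p─q⇒x∉q p q x∈p─q x∈q

x∈p-y⇒x∈p : ∀ {n} {p : Subset n} {x y} → x ∈ₛ p - y → x ∈ₛ p
x∈p-y⇒x∈p {p = p} {y = y} = p─q⊆p p ⁅ y ⁆

x∈p-y⇒x≢y : ∀ {n} {p : Subset n} {x y} → x ∈ₛ p - y → x ≢ y
x∈p-y⇒x≢y {p = p} {y = y} x∈p-y refl = x∈p─q⇒x∉q p ⁅ y ⁆ x∈p-y (x∈⁅x⁆ y)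

x∈p⇒∣p∣≡1+∣p-x∣ : ∀ {n} {p : Subset n} {x} → x ∈ₛ p → ∣ p ∣ ≡ suc ∣ p - x ∣
x∈p⇒∣p∣≡1+∣p-x∣ {p = inside ∷ p} here = cong (suc ∘ ∣_∣) (sym (p─⊥≡p p))
x∈p⇒∣p∣≡1+∣p-x∣ {p = inside ∷ p} (there x∈p) = cong suc (x∈p⇒∣p∣≡1+∣p-x∣ x∈p)
x∈p⇒∣p∣≡1+∣p-x∣ {p = outside ∷ p} (there x∈p) = x∈p⇒∣p∣≡1+∣p-x∣ x∈p

Empty⇒∣p∣≡0 : ∀ {n} {p : Subset n} → Empty p → ∣ p ∣ ≡ 0
Empty⇒∣p∣≡0 {n} empty = trans (cong ∣_∣ (Empty-unique empty)) (∣⊥∣≡0 n)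

x∈p⇒1≤∣p∣ : ∀ {n} {p : Subset n} {x} → x ∈ₛ p → 1 ≤ ∣ p ∣
x∈p⇒1≤∣p∣ x∈p = subst (1 ≤_) (sym (x∈p⇒∣p∣≡1+∣p-x∣ x∈p)) (s≤s z≤n)

1≤∣p∣⇒Nonempty : ∀ {n} (p : Subset n) → 1 ≤ ∣ p ∣ → Nonempty p
1≤∣p∣⇒Nonempty p 1≤∣p∣ with nonempty? p
... | yes nonempty = nonempty
... | no empty = ⊥-elim (<⇒≢ 1≤∣p∣ (sym (Empty⇒∣p∣≡0 empty)))

∣p∣≤1 : ∀ {n} (p : Subset n) → (∀ {x y} → x ∈ₛ p → y ∈ₛ p → x ≡ y) → ∣ p ∣ ≤ 1
∣p∣≤1 [] _ = z≤n
∣p∣≤1 (outside ∷ p) unique = ∣p∣≤1 p (λ x∈p y∈p → Fin.suc-injective (unique (there x∈p) (there y∈p)))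
∣p∣≤1 (inside ∷ p) unique = s≤s (≤-reflexive (Empty⇒∣p∣≡0 (λ (_ , x∈p) → 0≢suc (unique here (there x∈p)))))
  where
  0≢suc : ∀ {n} {x : Fin n} → zero ≢ suc x
  0≢suc ()

2≤∣p∣ : ∀ {n} {p : Subset n} {x y} → x ∈ₛ p → y ∈ₛ p → x ≢ y → 2 ≤ ∣ p ∣
2≤∣p∣ x∈p y∈p x≢y = subst (2 ≤_) (sym (x∈p⇒∣p∣≡1+∣p-x∣ x∈p))
  (s≤s (x∈p⇒1≤∣p∣ (x∈p∧x≢y⇒x∈p-y y∈p (x≢y ∘ sym))))

∣p∣≡2 : ∀ {n} {p : Subset n} {x y} → x ∈ₛ p → y ∈ₛ p → x ≢ y →
  (∀ {z} → z ∈ₛ p → z ≡ x ⊎ z ≡ y) → ∣ p ∣ ≡ 2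
∣p∣≡2 {p = p} {x} {y} x∈p y∈p x≢y within = trans (x∈p⇒∣p∣≡1+∣p-x∣ x∈p) (cong suc (≤-antisym
  (∣p∣≤1 (p - x) (λ z∈ z′∈ → trans (only-y z∈) (sym (only-y z′∈))))
  (x∈p⇒1≤∣p∣ (x∈p∧x≢y⇒x∈p-y y∈p (x≢y ∘ sym)))))
  where
  only-y : ∀ {z} → z ∈ₛ p - x → z ≡ y
  only-y z∈p-x with within (x∈p-y⇒x∈p z∈p-x)
  ... | inj₁ z≡x = ⊥-elim (x∈p-y⇒x≢y z∈p-x z≡x)
  ... | inj₂ z≡y = z≡y

Σ∈ : ∀ {n} → (Fin n → ℕ) → Subset n → ℕ
Σ∈ g [] = 0
Σ∈ g (inside ∷ p) = g zero + Σ∈ (g ∘ suc) p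
Σ∈ g (outside ∷ p) = Σ∈ (g ∘ suc) p

x∈p⇒Σ∈p≡g[x]+Σ∈[p-x] : ∀ {n} (g : Fin n → ℕ) {p x} → x ∈ₛ p → Σ∈ g p ≡ g x + Σ∈ g (p - x)
x∈p⇒Σ∈p≡g[x]+Σ∈[p-x] g {inside ∷ p} here = cong (λ q → g zero + Σ∈ (g ∘ suc) q) (sym (p─⊥≡p p))
x∈p⇒Σ∈p≡g[x]+Σ∈[p-x] g {inside ∷ p} {suc x} (there x∈p) = begin
  g zero + Σ∈ (g ∘ suc) p                          ≡⟨ cong (g zero +_) (x∈p⇒Σ∈p≡g[x]+Σ∈[p-x] (g ∘ suc) x∈p) ⟩
  g zero + (g (suc x) + Σ∈ (g ∘ suc) (p - x))      ≡⟨ x+[y+z]≡y+[x+z] (g zero) (g (suc x)) _ ⟩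
  g (suc x) + (g zero + Σ∈ (g ∘ suc) (p - x))      ∎
  where open ≡-Reasoning
x∈p⇒Σ∈p≡g[x]+Σ∈[p-x] g {outside ∷ p} (there x∈p) = x∈p⇒Σ∈p≡g[x]+Σ∈[p-x] (g ∘ suc) x∈p

mod-cancel : ∀ n .{{_ : NonZero n}} {a b x y} → a < n → b < n → a + x ≡ b + y → x % n ≡ y % n → a ≡ b
mod-cancel n {a} {b} {x} {y} a<n b<n a+x≡b+y x%n≡y%n = begin
  a                       ≡⟨ m<n⇒m%n≡m a<n ⟨
  a % n                   ≡⟨ [m+kn]%n≡m%n a (x / n) n ⟨
  (a + x / n * n) % n     ≡⟨ cong (_% n) quotients ⟩
  (b + y / n * n) % n     ≡⟨ [m+kn]%n≡m%n b (y / n) n ⟩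
  b % n                   ≡⟨ m<n⇒m%n≡m b<n ⟩
  b                       ∎
  where
  open ≡-Reasoning
  split : ∀ u v → u + v ≡ (u + v / n * n) + v % n
  split u v = trans (cong (u +_) (trans (m≡m%n+[m/n]*n v n) (+-comm (v % n) _))) (sym (+-assoc u _ _))
  quotients : a + x / n * n ≡ b + y / n * n
  quotients = +-cancelʳ-≡ (x % n) _ _ (begin
    a + x / n * n + x % n   ≡⟨ split a x ⟨
    a + x                   ≡⟨ a+x≡b+y ⟩
    b + y                   ≡⟨ split b y ⟩
    b + y / n * n + y % n   ≡⟨ cong (b + y / n * n +_) x%n≡y%n ⟨
    b + y / n * n + x % n   ∎)

module _ {A : Set} where

  pair-⊆ : ∀ {d₁ d₂ p q : A} → d₁ ≢ d₂ → d₁ ≡ p ⊎ d₁ ≡ q → d₂ ≡ p ⊎ d₂ ≡ q → p ≡ d₁ ⊎ p ≡ d₂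
  pair-⊆ _ (inj₁ d₁≡p) _ = inj₁ (sym d₁≡p)
  pair-⊆ _ (inj₂ _) (inj₁ d₂≡p) = inj₂ (sym d₂≡p)
  pair-⊆ d₁≢d₂ (inj₂ d₁≡q) (inj₂ d₂≡q) = ⊥-elim (d₁≢d₂ (trans d₁≡q (sym d₂≡q)))

  no-three-in-pair : ∀ {a b x y w : A} → x ≢ y → x ≢ w → y ≢ w →
    x ≡ a ⊎ x ≡ b → y ≡ a ⊎ y ≡ b → w ≡ a ⊎ w ≡ b → ⊥
  no-three-in-pair x≢y _ _ (inj₁ refl) (inj₁ refl) _ = x≢y refl
  no-three-in-pair x≢y _ _ (inj₂ refl) (inj₂ refl) _ = x≢y refl
  no-three-in-pair _ x≢w _ (inj₁ refl) _ (inj₁ refl) = x≢w refl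
  no-three-in-pair _ x≢w _ (inj₂ refl) _ (inj₂ refl) = x≢w refl
  no-three-in-pair _ _ y≢w _ (inj₁ refl) (inj₁ refl) = y≢w refl
  no-three-in-pair _ _ y≢w _ (inj₂ refl) (inj₂ refl) = y≢w refl

  avoid-pair : DecidableEquality A → (z : Fin 3 → A) → Injective _≡_ _≡_ z →
    ∀ a b → ∃ λ u → z u ≢ a × z u ≢ b
  avoid-pair _≟_ z z-inj a b with side zero | side (suc zero) | side (suc (suc zero))
    where
    side : ∀ u → (z u ≢ a × z u ≢ b) ⊎ (z u ≡ a ⊎ z u ≡ b)
    side u with z u ≟ a | z u ≟ b
    ... | yes ≡a | _ = inj₂ (inj₁ ≡a)
    ... | no _ | yes ≡b = inj₂ (inj₂ ≡b)
    ... | no ≢a | no ≢b = inj₁ (≢a , ≢b)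
  ... | inj₁ avoids | _ | _ = zero , avoids
  ... | inj₂ _ | inj₁ avoids | _ = suc zero , avoids
  ... | inj₂ _ | inj₂ _ | inj₁ avoids = suc (suc zero) , avoids
  ... | inj₂ in₀ | inj₂ in₁ | inj₂ in₂ =
    ⊥-elim (no-three-in-pair (distinct (λ ())) (distinct (λ ())) (distinct (λ ())) in₀ in₁ in₂)
    where
    distinct : ∀ {u v} → u ≢ v → z u ≢ z v
    distinct u≢v = u≢v ∘ z-inj

the-other-two : (u : Fin 3) → ∃ λ v → ∃ λ w → v ≢ w × v ≢ u × w ≢ u
the-other-two zero = suc zero , suc (suc zero) , (λ ()) , (λ ()) , (λ ())
the-other-two (suc zero) = zero , suc (suc zero) , (λ ()) , (λ ()) , (λ ())
the-other-two (suc (suc zero)) = zero , suc zero , (λ ()) , (λ ()) , (λ ())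

Fin-trivial-or-3≤1+ : ∀ t → 1 ≤ t → (∀ (x y : Fin t) → x ≡ y) ⊎ 3 ≤ suc t
Fin-trivial-or-3≤1+ (suc zero) _ = inj₁ λ { zero zero → refl }
Fin-trivial-or-3≤1+ (suc (suc t)) _ = inj₂ (s≤s (s≤s (s≤s z≤n)))

∑ : ∀ m → (Subset m → ℕ) → ℕ
∑ zero g = g []
∑ (suc m) g = ∑ m (g ∘ (inside ∷_)) + ∑ m (g ∘ (outside ∷_))

∑-cong : ∀ m {g h : Subset m → ℕ} → (∀ v → g v ≡ h v) → ∑ m g ≡ ∑ m h
∑-cong zero g≡h = g≡h []
∑-cong (suc m) g≡h = cong₂ _+_ (∑-cong m (g≡h ∘ (inside ∷_))) (∑-cong m (g≡h ∘ (outside ∷_)))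

∑-≡0 : ∀ m {g : Subset m → ℕ} → (∀ v → g v ≡ 0) → ∑ m g ≡ 0
∑-≡0 zero g≡0 = g≡0 []
∑-≡0 (suc m) g≡0 = cong₂ _+_ (∑-≡0 m (g≡0 ∘ (inside ∷_))) (∑-≡0 m (g≡0 ∘ (outside ∷_)))

∑-+ : ∀ m (g h : Subset m → ℕ) → ∑ m (λ v → g v + h v) ≡ ∑ m g + ∑ m h
∑-+ zero g h = refl
∑-+ (suc m) g h = begin
  ∑ m (λ v → g (inside ∷ v) + h (inside ∷ v)) + ∑ m (λ v → g (outside ∷ v) + h (outside ∷ v))
    ≡⟨ cong₂ _+_ (∑-+ m (g ∘ (inside ∷_)) (h ∘ (inside ∷_))) (∑-+ m (g ∘ (outside ∷_)) (h ∘ (outside ∷_))) ⟩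
  (gi + hi) + (go + ho)
    ≡⟨ [w+x]+[y+z]≡[w+y]+[x+z] gi hi go ho ⟩
  (gi + go) + (hi + ho) ∎
  where
  open ≡-Reasoning
  gi = ∑ m (g ∘ (inside ∷_))
  go = ∑ m (g ∘ (outside ∷_))
  hi = ∑ m (h ∘ (inside ∷_))
  ho = ∑ m (h ∘ (outside ∷_))

∑-++ : ∀ a b (g : Subset (a + b) → ℕ) → ∑ (a + b) g ≡ ∑ a (λ x → ∑ b (λ y → g (x ++ y)))
∑-++ zero b g = refl
∑-++ (suc a) b g = cong₂ _+_ (∑-++ a b (g ∘ (inside ∷_))) (∑-++ a b (g ∘ (outside ∷_)))

∑-size : ∀ m r → ∑ m (λ v → 𝟙 (∣ v ∣ ≡ᵇ r)) ≡ m C r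
∑-size zero zero = refl
∑-size zero (suc r) = refl
∑-size (suc m) zero = cong₂ _+_ (∑-≡0 m (λ _ → refl)) (∑-size m zero)
∑-size (suc m) (suc r) =
  trans (cong₂ _+_ (∑-size m r) (∑-size m (suc r))) (nCk+nC[k+1]≡[n+1]C[k+1] m r)

∑-by-size : ∀ t (h : ℕ → ℕ) → (∀ j → h (3 + j) ≡ 0) →
  ∑ t (h ∘ ∣_∣) ≡ h 0 + t * h 1 + (t C 2) * h 2
∑-by-size zero h _ = sym (trans (+-identityʳ _) (+-identityʳ (h 0)))
∑-by-size (suc t) h h≡0 = begin
  ∑ t (h ∘ suc ∘ ∣_∣) + ∑ t (h ∘ ∣_∣)
    ≡⟨ cong₂ _+_ (∑-by-size t (h ∘ suc) (h≡0 ∘ suc)) (∑-by-size t h h≡0) ⟩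
  (h 1 + t * h 2 + (t C 2) * h 3) + (h 0 + t * h 1 + (t C 2) * h 2)
    ≡⟨ cong (λ z → (h 1 + t * h 2 + (t C 2) * z) + (h 0 + t * h 1 + (t C 2) * h 2)) (h≡0 0) ⟩
  (h 1 + t * h 2 + (t C 2) * 0) + (h 0 + t * h 1 + (t C 2) * h 2)
    ≡⟨ regroup (h 0) (h 1) (h 2) t (t C 2) ⟩
  h 0 + suc t * h 1 + (t + t C 2) * h 2
    ≡⟨ cong (λ z → h 0 + suc t * h 1 + z * h 2) (pascal₂ t) ⟩
  h 0 + suc t * h 1 + (suc t C 2) * h 2 ∎
  where
  open ≡-Reasoning
  regroup : ∀ a b c t B → (b + t * c + B * 0) + (a + t * b + B * c) ≡ a + suc t * b + (t + B) * c
  regroup = solve-∀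
  pascal₂ : ∀ t → t + t C 2 ≡ suc t C 2
  pascal₂ t = trans (cong (_+ (t C 2)) (sym (nC1≡n t))) (nCk+nC[k+1]≡[n+1]C[k+1] t 1)

allSubsets : ∀ m → List (Subset m)
allSubsets zero = [] ∷ []
allSubsets (suc m) = map (inside ∷_) (allSubsets m) ++ₗ map (outside ∷_) (allSubsets m)

allSubsets-unique : ∀ m → Unique (allSubsets m)
allSubsets-unique zero = [] ∷ []
allSubsets-unique (suc m) =
  Unique.++⁺ (Unique.map⁺ ∷-injectiveʳ (allSubsets-unique m))
             (Unique.map⁺ ∷-injectiveʳ (allSubsets-unique m)) disjoint
  where
  disjoint : ∀ {v} → ¬ (v ∈ map (inside ∷_) (allSubsets m) × v ∈ map (outside ∷_) (allSubsets m))
  disjoint (v∈ᵢ , v∈ₒ) with ∈-map⁻ (inside ∷_) v∈ᵢ | ∈-map⁻ (outside ∷_) v∈ₒ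
  ... | _ , _ , refl | _ , _ , ()

sum-map-allSubsets : ∀ m (g : Subset m → ℕ) → sum (map g (allSubsets m)) ≡ ∑ m g
sum-map-allSubsets zero g = +-identityʳ (g [])
sum-map-allSubsets (suc m) g = begin
  sum (map g (map (inside ∷_) vs ++ₗ map (outside ∷_) vs))
    ≡⟨ cong sum (map-++ g (map (inside ∷_) vs) _) ⟩
  sum (map g (map (inside ∷_) vs) ++ₗ map g (map (outside ∷_) vs))
    ≡⟨ sum-++ (map g (map (inside ∷_) vs)) _ ⟩
  sum (map g (map (inside ∷_) vs)) + sum (map g (map (outside ∷_) vs))
    ≡⟨ cong₂ _+_ (cong sum (sym (map-∘ vs))) (cong sum (sym (map-∘ vs))) ⟩
  sum (map (g ∘ (inside ∷_)) vs) + sum (map (g ∘ (outside ∷_)) vs)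
    ≡⟨ cong₂ _+_ (sum-map-allSubsets m _) (sum-map-allSubsets m _) ⟩
  ∑ (suc m) g ∎
  where
  open ≡-Reasoning
  vs = allSubsets m

length-filterᵇ : ∀ {A : Set} (p : A → Bool) xs → length (filterᵇ p xs) ≡ sum (map (𝟙 ∘ p) xs)
length-filterᵇ p [] = refl
length-filterᵇ p (x ∷ xs) with p x
... | true = cong suc (length-filterᵇ p xs)
... | false = length-filterᵇ p xs

length-filterᵇ-allSubsets : ∀ m (p : Subset m → Bool) → length (filterᵇ p (allSubsets m)) ≡ ∑ m (𝟙 ∘ p)
length-filterᵇ-allSubsets m p = trans (length-filterᵇ p (allSubsets m)) (sum-map-allSubsets m (𝟙 ∘ p))

module _ {A : Set} (_≟_ : DecidableEquality A) where
  open import Data.List.Membership.DecPropositional _≟_ using (_∈?_)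

  𝟙-∧-∈? : ∀ b x (L : List A) → Unique L → 𝟙 (b ∧ does (x ∈? L)) ≡ sum (map (λ g → 𝟙 (b ∧ does (x ≟ g))) L)
  𝟙-∧-∈? false x L _ = sym (sum-map-≡0 L)
    where
    sum-map-≡0 : ∀ L → sum (map (λ g → 𝟙 (false ∧ does (x ≟ g))) L) ≡ 0
    sum-map-≡0 [] = refl
    sum-map-≡0 (_ ∷ L) = sum-map-≡0 L
  𝟙-∧-∈? true x [] _ = refl
  𝟙-∧-∈? true x (g ∷ L) (g∉L ∷ L-unique) with x ≟ g
  ... | yes refl = cong suc (sym (sum-map-≡0 L g∉L))
    where
    sum-map-≡0 : ∀ L → All (x ≢_) L → sum (map (λ g → 𝟙 (does (x ≟ g))) L) ≡ 0
    sum-map-≡0 [] [] = refl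
    sum-map-≡0 (g ∷ L) (x≢g ∷ x∉L) with x ≟ g
    ... | yes x≡g = ⊥-elim (x≢g x≡g)
    ... | no _ = sum-map-≡0 L x∉L
  ... | no _ = 𝟙-∧-∈? true x L L-unique

∑-sum-map : ∀ {A : Set} m (L : List A) (h : A → Subset m → ℕ) →
  ∑ m (λ e → sum (map (λ g → h g e) L)) ≡ sum (map (λ g → ∑ m (h g)) L)
∑-sum-map m [] h = ∑-≡0 m (λ _ → refl)
∑-sum-map m (g ∷ L) h = trans (∑-+ m (h g) _) (cong (∑ m (h g) +_) (∑-sum-map m L h))

sum-map≤length*max : ∀ {A : Set} (g : A → ℕ) x xs → ∃ λ y → sum (map g (x ∷ xs)) ≤ length (x ∷ xs) * g y
sum-map≤length*max g x [] = x , ≤-refl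
sum-map≤length*max g x (x′ ∷ xs) with sum-map≤length*max g x′ xs
... | y , bound with g x ≤? g y
...   | yes gx≤gy = y , +-mono-≤ gx≤gy bound
...   | no gx≰gy = x , +-monoʳ-≤ (g x) (≤-trans bound (*-monoʳ-≤ (length (x′ ∷ xs)) (<⇒≤ (≰⇒> gx≰gy))))

sum-allFin≤n*max : ∀ n .{{_ : NonZero n}} (g : Fin n → ℕ) → ∃ λ c → sum (map g (allFin n)) ≤ n * g c
sum-allFin≤n*max (suc n) g with sum-map≤length*max g zero (tabulate suc)
... | c , bound = c , subst (λ l → sum (map g (allFin (suc n))) ≤ l * g c) (length-tabulate {n = suc n} id) bound

_≟ₛ_ : ∀ {n} → DecidableEquality (Subset n)
_≟ₛ_ = ≡-dec Bool._≟_

_∈?_ : ∀ {n} → Decidable₂ (_∈_ {A = Subset n})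
_∈?_ = DecMembership._∈?_ _≟ₛ_

2*[tC2]≡t*[t∸1] : ∀ t → 2 * (t C 2) ≡ t * (t ∸ 1)
2*[tC2]≡t*[t∸1] zero = refl
2*[tC2]≡t*[t∸1] (suc zero) = refl
2*[tC2]≡t*[t∸1] (suc (suc t)) = begin
  2 * (suc (suc t) C 2)              ≡⟨ cong (2 *_) (nCk+nC[k+1]≡[n+1]C[k+1] (suc t) 1) ⟨
  2 * ((suc t C 1) + (suc t C 2))    ≡⟨ cong (λ x → 2 * (x + (suc t C 2))) (nC1≡n (suc t)) ⟩
  2 * (suc t + (suc t C 2))          ≡⟨ *-distribˡ-+ 2 (suc t) _ ⟩
  2 * suc t + 2 * (suc t C 2)        ≡⟨ cong (2 * suc t +_) (2*[tC2]≡t*[t∸1] (suc t)) ⟩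
  2 * suc t + suc t * t              ≡⟨ regroup t ⟩
  suc (suc t) * suc t                ∎
  where
  open ≡-Reasoning
  regroup : ∀ t → 2 * suc t + suc t * t ≡ suc (suc t) * suc t
  regroup = solve-∀

-- Fin (n * t) is split into n blocks of size t: combine x ℓ is vertex ℓ of block x.
module Blocks (t : ℕ) where

  block : ∀ n → Subset (n * t) → Fin n → Subset t
  block (suc n) e zero = take t e
  block (suc n) e (suc x) = block n (drop t e) x

  lookup-combine : ∀ n (e : Subset (n * t)) x ℓ → lookup e (combine x ℓ) ≡ lookup (block n e x) ℓ
  lookup-combine (suc n) e zero ℓ = lookup-↑ˡ t e ℓ
  lookup-combine (suc n) e (suc x) ℓ = trans (lookup-↑ʳ t e (combine x ℓ)) (lookup-combine n (drop t e) x ℓ)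

  transversalᵇ : ∀ n → Subset (n * t) → Bool
  transversalᵇ zero e = true
  transversalᵇ (suc n) e = (∣ take t e ∣ ≤ᵇ 1) ∧ transversalᵇ n (drop t e)

  oneDoubleᵇ : ∀ n → Subset (n * t) → Bool
  oneDoubleᵇ zero e = false
  oneDoubleᵇ (suc n) e = ((∣ take t e ∣ ≡ᵇ 2) ∧ transversalᵇ n (drop t e))
                       ∨ ((∣ take t e ∣ ≤ᵇ 1) ∧ oneDoubleᵇ n (drop t e))

  shadow : ∀ n → Subset (n * t) → Subset n
  shadow zero e = []
  shadow (suc n) e = (1 ≤ᵇ ∣ take t e ∣) ∷ shadow n (drop t e)

  crowdedᵇ : ∀ n → Subset (n * t) → Bool
  crowdedᵇ n e = not (transversalᵇ n e) ∧ not (oneDoubleᵇ n e)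

  ∈-block⁺ : ∀ n {e} x ℓ → combine x ℓ ∈ₛ e → ℓ ∈ₛ block n e x
  ∈-block⁺ n {e} x ℓ ∈e = lookup⇒[]= ℓ (block n e x) (trans (sym (lookup-combine n e x ℓ)) ([]=⇒lookup ∈e))

  ∈-block⁻ : ∀ n {e} x ℓ → ℓ ∈ₛ block n e x → combine x ℓ ∈ₛ e
  ∈-block⁻ n {e} x ℓ ∈block = lookup⇒[]= (combine x ℓ) e (trans (lookup-combine n e x ℓ) ([]=⇒lookup ∈block))

  transversal⇒∣block∣≤1 : ∀ n {e} → T (transversalᵇ n e) → ∀ x → ∣ block n e x ∣ ≤ 1
  transversal⇒∣block∣≤1 (suc n) {e} tr zero = ≤ᵇ⇒≤ ∣ take t e ∣ 1 (proj₁ (T-∧⁻ (∣ take t e ∣ ≤ᵇ 1) tr))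
  transversal⇒∣block∣≤1 (suc n) {e} tr (suc x) =
    transversal⇒∣block∣≤1 n (proj₂ (T-∧⁻ (∣ take t e ∣ ≤ᵇ 1) tr)) x

  ∣block∣≤1⇒transversal : ∀ n {e} → (∀ x → ∣ block n e x ∣ ≤ 1) → T (transversalᵇ n e)
  ∣block∣≤1⇒transversal zero _ = _
  ∣block∣≤1⇒transversal (suc n) ≤1 = T-∧⁺ (≤⇒≤ᵇ (≤1 zero)) (∣block∣≤1⇒transversal n (≤1 ∘ suc))

  oneDouble-intro : ∀ n {e} x → ∣ block n e x ∣ ≡ 2 → (∀ y → y ≢ x → ∣ block n e y ∣ ≤ 1) →
    T (oneDoubleᵇ n e)
  oneDouble-intro (suc n) zero ≡2 ≤1 =
    T-∨⁺ˡ (T-∧⁺ (≡⇒≡ᵇ _ 2 ≡2) (∣block∣≤1⇒transversal n (λ y → ≤1 (suc y) (λ ()))))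
  oneDouble-intro (suc n) (suc x) ≡2 ≤1 = T-∨⁺ʳ (T-∧⁺ (≤⇒≤ᵇ (≤1 zero (λ ())))
    (oneDouble-intro n x ≡2 (λ y y≢x → ≤1 (suc y) (y≢x ∘ Fin.suc-injective))))

  oneDouble⇒¬transversal : ∀ n {e} → T (oneDoubleᵇ n e) → ¬ T (transversalᵇ n e)
  oneDouble⇒¬transversal (suc n) {e} od tr
    with T-∨⁻ ((∣ take t e ∣ ≡ᵇ 2) ∧ transversalᵇ n (drop t e)) od | T-∧⁻ (∣ take t e ∣ ≤ᵇ 1) tr
  ... | inj₁ double | ≤1 , _ =
    <⇒≱ (≤-reflexive (sym (≡ᵇ⇒≡ ∣ take t e ∣ 2 (proj₁ (T-∧⁻ (∣ take t e ∣ ≡ᵇ 2) double))))) (≤ᵇ⇒≤ ∣ take t e ∣ 1 ≤1)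
  ... | inj₂ rest | _ , tr′ = oneDouble⇒¬transversal n (proj₂ (T-∧⁻ (∣ take t e ∣ ≤ᵇ 1) rest)) tr′

  lookup-shadow : ∀ n e x → lookup (shadow n e) x ≡ (1 ≤ᵇ ∣ block n e x ∣)
  lookup-shadow (suc n) e zero = refl
  lookup-shadow (suc n) e (suc x) = lookup-shadow n (drop t e) x

  ∈-shadow⁺ : ∀ n {e} x {ℓ} → ℓ ∈ₛ block n e x → x ∈ₛ shadow n e
  ∈-shadow⁺ n {e} x ℓ∈ = lookup⇒[]= x (shadow n e)
    (trans (lookup-shadow n e x) (Equivalence.to T-≡ (≤⇒≤ᵇ (x∈p⇒1≤∣p∣ ℓ∈))))

  ∈-shadow⁻ : ∀ n {e} x → x ∈ₛ shadow n e → Nonempty (block n e x)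
  ∈-shadow⁻ n {e} x x∈ = 1≤∣p∣⇒Nonempty (block n e x)
    (≤ᵇ⇒≤ 1 ∣ block n e x ∣ (Equivalence.from T-≡ (trans (sym (lookup-shadow n e x)) ([]=⇒lookup x∈))))

  transversal⇒∣shadow∣ : ∀ n e → T (transversalᵇ n e) → ∣ e ∣ ≡ ∣ shadow n e ∣
  transversal⇒∣shadow∣ zero [] _ = refl
  transversal⇒∣shadow∣ (suc n) e tr with T-∧⁻ (∣ take t e ∣ ≤ᵇ 1) tr
  ... | ≤1 , tr′ = trans (∣take∣+∣drop∣ t e)
    (step ∣ take t e ∣ (shadow n (drop t e)) (≤ᵇ⇒≤ ∣ take t e ∣ 1 ≤1) (transversal⇒∣shadow∣ n (drop t e) tr′))
    where
    step : ∀ j {a} (v : Subset n) → j ≤ 1 → a ≡ ∣ v ∣ → j + a ≡ ∣ (1 ≤ᵇ j) ∷ v ∣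
    step zero v _ a≡ = a≡
    step (suc zero) v _ a≡ = cong suc a≡
    step (suc (suc _)) v (s≤s ()) _

module Counting (t : ℕ) where
  open Blocks t

  ∑-by-first-block : ∀ n (g : Subset (suc n * t) → ℕ) (H : ℕ → Subset (n * t) → ℕ) →
    (∀ a b → g (a ++ b) ≡ H ∣ a ∣ b) → (∀ j b → H (3 + j) b ≡ 0) →
    ∑ (suc n * t) g ≡ ∑ (n * t) (H 0) + t * ∑ (n * t) (H 1) + (t C 2) * ∑ (n * t) (H 2)
  ∑-by-first-block n g H g≡H H≡0 = begin
    ∑ (t + n * t) g                                   ≡⟨ ∑-++ t (n * t) g ⟩
    ∑ t (λ a → ∑ (n * t) (λ b → g (a ++ b)))          ≡⟨ ∑-cong t (λ a → ∑-cong (n * t) (g≡H a)) ⟩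
    ∑ t (λ a → ∑ (n * t) (H ∣ a ∣))                   ≡⟨ ∑-by-size t (λ j → ∑ (n * t) (H j)) (λ j → ∑-≡0 (n * t) (H≡0 j)) ⟩
    ∑ (n * t) (H 0) + t * ∑ (n * t) (H 1) + (t C 2) * ∑ (n * t) (H 2) ∎
    where open ≡-Reasoning

  #transversals : ℕ → ℕ → ℕ
  #transversals n r = ∑ (n * t) (λ e → 𝟙 ((∣ e ∣ ≡ᵇ r) ∧ transversalᵇ n e))

  #transversals-step : ∀ n r → #transversals (suc n) r ≡
    #transversals n r + t * ∑ (n * t) (λ b → 𝟙 ((suc ∣ b ∣ ≡ᵇ r) ∧ transversalᵇ n b)) + (t C 2) * 0
  #transversals-step n r = trans (∑-by-first-block n _ H first-block (λ _ _ → refl))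
    (cong (λ z → #transversals n r + t * ∑ (n * t) (H 1) + (t C 2) * z) (∑-≡0 (n * t) (λ _ → refl)))
    where
    H : ℕ → Subset (n * t) → ℕ
    H j b = 𝟙 ((j ≤ᵇ 1) ∧ ((j + ∣ b ∣ ≡ᵇ r) ∧ transversalᵇ n b))
    first-block : ∀ a b → 𝟙 ((∣ a ++ b ∣ ≡ᵇ r) ∧ transversalᵇ (suc n) (a ++ b)) ≡ H ∣ a ∣ b
    first-block a b rewrite ∣++∣ a b | take-++ a b | drop-++ a b =
      cong 𝟙 (x∧[y∧z]≡y∧[x∧z] (∣ a ∣ + ∣ b ∣ ≡ᵇ r) (∣ a ∣ ≤ᵇ 1) (transversalᵇ n b))

  #transversals≡ : ∀ n r → #transversals n r ≡ (n C r) * t ^ r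
  #transversals≡ zero zero = refl
  #transversals≡ zero (suc r) = refl
  #transversals≡ (suc n) zero = begin
    #transversals (suc n) 0                       ≡⟨ #transversals-step n 0 ⟩
    #transversals n 0 + t * ∑ (n * t) (λ _ → 0) + (t C 2) * 0
      ≡⟨ cong₂ (λ x z → x + t * z + (t C 2) * 0) (#transversals≡ n 0) (∑-≡0 (n * t) (λ _ → refl)) ⟩
    1 * 1 + t * 0 + (t C 2) * 0                   ≡⟨ drop-zeros t (t C 2) ⟩
    1 * 1                                         ∎
    where
    open ≡-Reasoning
    drop-zeros : ∀ a b → 1 * 1 + a * 0 + b * 0 ≡ 1 * 1
    drop-zeros = solve-∀
  #transversals≡ (suc n) (suc r) = begin
    #transversals (suc n) (suc r)                 ≡⟨ #transversals-step n (suc r) ⟩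
    #transversals n (suc r) + t * #transversals n r + (t C 2) * 0
      ≡⟨ cong₂ (λ x y → x + t * y + (t C 2) * 0) (#transversals≡ n (suc r)) (#transversals≡ n r) ⟩
    (n C suc r) * (t * t ^ r) + t * ((n C r) * t ^ r) + (t C 2) * 0
      ≡⟨ regroup t (t C 2) (n C r) (n C suc r) (t ^ r) ⟩
    ((n C r) + (n C suc r)) * (t * t ^ r)         ≡⟨ cong (_* t ^ suc r) (nCk+nC[k+1]≡[n+1]C[k+1] n r) ⟩
    (suc n C suc r) * t ^ suc r                   ∎
    where
    open ≡-Reasoning
    regroup : ∀ t B x y p → y * (t * p) + t * (x * p) + B * 0 ≡ (x + y) * (t * p)
    regroup = solve-∀

  #oneDoubles : ℕ → ℕ → ℕ
  #oneDoubles n r = ∑ (n * t) (λ e → 𝟙 ((∣ e ∣ ≡ᵇ r) ∧ oneDoubleᵇ n e))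

  #oneDoubles-step : ∀ n r → #oneDoubles (suc n) r ≡
    #oneDoubles n r
      + t * ∑ (n * t) (λ b → 𝟙 ((suc ∣ b ∣ ≡ᵇ r) ∧ oneDoubleᵇ n b))
      + (t C 2) * ∑ (n * t) (λ b → 𝟙 ((2 + ∣ b ∣ ≡ᵇ r) ∧ transversalᵇ n b))
  #oneDoubles-step n r = ∑-by-first-block n _ H first-block (λ _ _ → refl)
    where
    H : ℕ → Subset (n * t) → ℕ
    H 0 b = 𝟙 ((∣ b ∣ ≡ᵇ r) ∧ oneDoubleᵇ n b)
    H 1 b = 𝟙 ((suc ∣ b ∣ ≡ᵇ r) ∧ oneDoubleᵇ n b)
    H 2 b = 𝟙 ((2 + ∣ b ∣ ≡ᵇ r) ∧ transversalᵇ n b)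
    H (suc (suc (suc _))) b = 0
    by-size : ∀ j b →
      𝟙 ((j + ∣ b ∣ ≡ᵇ r) ∧ (((j ≡ᵇ 2) ∧ transversalᵇ n b) ∨ ((j ≤ᵇ 1) ∧ oneDoubleᵇ n b))) ≡ H j b
    by-size 0 b = refl
    by-size 1 b = refl
    by-size 2 b = cong (λ z → 𝟙 ((2 + ∣ b ∣ ≡ᵇ r) ∧ z)) (∨-identityʳ (transversalᵇ n b))
    by-size (suc (suc (suc j))) b = cong 𝟙 (∧-zeroʳ (3 + j + ∣ b ∣ ≡ᵇ r))
    first-block : ∀ a b → 𝟙 ((∣ a ++ b ∣ ≡ᵇ r) ∧ oneDoubleᵇ (suc n) (a ++ b)) ≡ H ∣ a ∣ b
    first-block a b rewrite ∣++∣ a b | take-++ a b | drop-++ a b = by-size ∣ a ∣ b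

  #oneDoubles-0 : ∀ n → #oneDoubles n 0 ≡ 0
  #oneDoubles-0 zero = refl
  #oneDoubles-0 (suc n) = begin
    #oneDoubles (suc n) 0                     ≡⟨ #oneDoubles-step n 0 ⟩
    #oneDoubles n 0 + t * ∑ (n * t) (λ _ → 0) + (t C 2) * ∑ (n * t) (λ _ → 0)
      ≡⟨ cong₂ (λ x z → x + t * z + (t C 2) * z) (#oneDoubles-0 n) (∑-≡0 (n * t) (λ _ → refl)) ⟩
    0 + t * 0 + (t C 2) * 0                   ≡⟨ zeros t (t C 2) ⟩
    0                                         ∎
    where
    open ≡-Reasoning
    zeros : ∀ a b → 0 + a * 0 + b * 0 ≡ 0
    zeros = solve-∀

  #oneDoubles-1 : ∀ n → #oneDoubles n 1 ≡ 0
  #oneDoubles-1 zero = refl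
  #oneDoubles-1 (suc n) = begin
    #oneDoubles (suc n) 1                     ≡⟨ #oneDoubles-step n 1 ⟩
    #oneDoubles n 1 + t * #oneDoubles n 0 + (t C 2) * ∑ (n * t) (λ _ → 0)
      ≡⟨ cong₃ (λ x y z → x + t * y + (t C 2) * z) (#oneDoubles-1 n) (#oneDoubles-0 n) (∑-≡0 (n * t) (λ _ → refl)) ⟩
    0 + t * 0 + (t C 2) * 0                   ≡⟨ zeros t (t C 2) ⟩
    0                                         ∎
    where
    open ≡-Reasoning
    zeros : ∀ a b → 0 + a * 0 + b * 0 ≡ 0
    zeros = solve-∀

  #pointed : ℕ → ℕ → ℕ
  #pointed n r = n * ((n ∸ 1) C r)

  #pointed-suc : ∀ n r → #pointed (suc n) (suc r) ≡ #pointed n (suc r) + #pointed n r + (n C suc r)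
  #pointed-suc zero r = refl
  #pointed-suc (suc m) r = begin
    suc (suc m) * (suc m C suc r)                             ≡⟨ cong (suc (suc m) *_) (sym (nCk+nC[k+1]≡[n+1]C[k+1] m r)) ⟩
    suc (suc m) * ((m C r) + (m C suc r))                     ≡⟨ regroup m (m C r) (m C suc r) ⟩
    suc m * (m C suc r) + suc m * (m C r) + ((m C r) + (m C suc r))
      ≡⟨ cong (suc m * (m C suc r) + suc m * (m C r) +_) (nCk+nC[k+1]≡[n+1]C[k+1] m r) ⟩
    suc m * (m C suc r) + suc m * (m C r) + (suc m C suc r)   ∎
    where
    open ≡-Reasoning
    regroup : ∀ m x y → suc (suc m) * (x + y) ≡ suc m * y + suc m * x + (x + y)
    regroup = solve-∀

  #oneDoubles-2+ : ∀ n r → #oneDoubles n (2 + r) ≡ t ^ r * (t C 2) * #pointed n r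
  #oneDoubles-2+ zero r = sym (*-zeroʳ (t ^ r * (t C 2)))
  #oneDoubles-2+ (suc n) zero = begin
    #oneDoubles (suc n) 2                                   ≡⟨ #oneDoubles-step n 2 ⟩
    #oneDoubles n 2 + t * #oneDoubles n 1 + (t C 2) * #transversals n 0
      ≡⟨ cong₃ (λ x y z → x + t * y + (t C 2) * z) (#oneDoubles-2+ n 0) (#oneDoubles-1 n) (#transversals≡ n 0) ⟩
    1 * (t C 2) * (n * 1) + t * 0 + (t C 2) * (1 * 1)      ≡⟨ regroup n t (t C 2) ⟩
    1 * (t C 2) * (suc n * 1)                               ∎
    where
    open ≡-Reasoning
    regroup : ∀ n t B → 1 * B * (n * 1) + t * 0 + B * (1 * 1) ≡ 1 * B * (suc n * 1)
    regroup = solve-∀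
  #oneDoubles-2+ (suc n) (suc r) = begin
    #oneDoubles (suc n) (3 + r)                             ≡⟨ #oneDoubles-step n (3 + r) ⟩
    #oneDoubles n (3 + r) + t * #oneDoubles n (2 + r) + (t C 2) * #transversals n (suc r)
      ≡⟨ cong₃ (λ x y z → x + t * y + (t C 2) * z) (#oneDoubles-2+ n (suc r)) (#oneDoubles-2+ n r) (#transversals≡ n (suc r)) ⟩
    t * t ^ r * (t C 2) * #pointed n (suc r) + t * (t ^ r * (t C 2) * #pointed n r)
      + (t C 2) * ((n C suc r) * (t * t ^ r))
      ≡⟨ regroup t (t C 2) (t ^ r) (#pointed n (suc r)) (#pointed n r) (n C suc r) ⟩
    t * t ^ r * (t C 2) * (#pointed n (suc r) + #pointed n r + (n C suc r))
      ≡⟨ cong (t ^ suc r * (t C 2) *_) (sym (#pointed-suc n r)) ⟩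
    t ^ suc r * (t C 2) * #pointed (suc n) (suc r)          ∎
    where
    open ≡-Reasoning
    regroup : ∀ t B p x y z → t * p * B * x + t * (p * B * y) + B * (z * (t * p)) ≡ t * p * B * (x + y + z)
    regroup = solve-∀

  2*#oneDoubles≡ : ∀ n r → 2 * #oneDoubles n (2 + r) ≡ n * t ^ suc r * (t ∸ 1) * ((n ∸ 1) C r)
  2*#oneDoubles≡ n r = begin
    2 * #oneDoubles n (2 + r)                          ≡⟨ cong (2 *_) (#oneDoubles-2+ n r) ⟩
    2 * (t ^ r * (t C 2) * (n * ((n ∸ 1) C r)))        ≡⟨ regroup (t ^ r) (t C 2) n ((n ∸ 1) C r) ⟩
    t ^ r * (2 * (t C 2)) * (n * ((n ∸ 1) C r))        ≡⟨ cong (λ x → t ^ r * x * (n * ((n ∸ 1) C r))) (2*[tC2]≡t*[t∸1] t) ⟩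
    t ^ r * (t * (t ∸ 1)) * (n * ((n ∸ 1) C r))        ≡⟨ regroup′ (t ^ r) t (t ∸ 1) n ((n ∸ 1) C r) ⟩
    n * (t * t ^ r) * (t ∸ 1) * ((n ∸ 1) C r)          ∎
    where
    open ≡-Reasoning
    regroup : ∀ p B n b → 2 * (p * B * (n * b)) ≡ p * (2 * B) * (n * b)
    regroup = solve-∀
    regroup′ : ∀ p t u n b → p * (t * u) * (n * b) ≡ n * (t * p) * u * b
    regroup′ = solve-∀

  #transversals-with-shadow : ∀ n (g : Subset n) →
    ∑ (n * t) (λ e → 𝟙 (transversalᵇ n e ∧ does (shadow n e ≟ₛ g))) ≡ t ^ ∣ g ∣
  #transversals-with-shadow zero [] = refl
  #transversals-with-shadow (suc n) (s ∷ g) = trans (∑-by-first-block n _ (H s) first-block (λ _ _ → refl)) (by-side s)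
    where
    H : Bool → ℕ → Subset (n * t) → ℕ
    H s j b = 𝟙 (((j ≤ᵇ 1) ∧ transversalᵇ n b) ∧ (does ((1 ≤ᵇ j) Bool.≟ s) ∧ does (shadow n b ≟ₛ g)))
    first-block : ∀ a b →
      𝟙 (transversalᵇ (suc n) (a ++ b) ∧ does (shadow (suc n) (a ++ b) ≟ₛ (s ∷ g))) ≡ H s ∣ a ∣ b
    first-block a b rewrite take-++ a b | drop-++ a b = refl
    never : ∑ (n * t) (λ b → 𝟙 (transversalᵇ n b ∧ false)) ≡ 0
    never = ∑-≡0 (n * t) (λ b → cong 𝟙 (∧-zeroʳ (transversalᵇ n b)))
    by-side : ∀ s → ∑ (n * t) (H s 0) + t * ∑ (n * t) (H s 1) + (t C 2) * ∑ (n * t) (H s 2) ≡ t ^ ∣ s ∷ g ∣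
    by-side outside = begin
      ∑ (n * t) (H outside 0) + t * ∑ (n * t) (λ b → 𝟙 (transversalᵇ n b ∧ false)) + (t C 2) * ∑ (n * t) (λ _ → 0)
        ≡⟨ cong₃ (λ x y z → x + t * y + (t C 2) * z) (#transversals-with-shadow n g) never (∑-≡0 (n * t) (λ _ → refl)) ⟩
      t ^ ∣ g ∣ + t * 0 + (t C 2) * 0                 ≡⟨ drop-zeros (t ^ ∣ g ∣) t (t C 2) ⟩
      t ^ ∣ g ∣                                       ∎
      where
      open ≡-Reasoning
      drop-zeros : ∀ p t B → p + t * 0 + B * 0 ≡ p
      drop-zeros = solve-∀
    by-side inside = begin
      ∑ (n * t) (λ b → 𝟙 (transversalᵇ n b ∧ false)) + t * ∑ (n * t) (H inside 1) + (t C 2) * ∑ (n * t) (λ _ → 0)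
        ≡⟨ cong₃ (λ x y z → x + t * y + (t C 2) * z) never (#transversals-with-shadow n g) (∑-≡0 (n * t) (λ _ → refl)) ⟩
      0 + t * t ^ ∣ g ∣ + (t C 2) * 0                 ≡⟨ drop-zeros (t ^ ∣ g ∣) t (t C 2) ⟩
      t * t ^ ∣ g ∣                                   ∎
      where
      open ≡-Reasoning
      drop-zeros : ∀ p t B → 0 + t * p + B * 0 ≡ t * p
      drop-zeros = solve-∀

  #transversals-with-shadow-in : ∀ n r (L : List (Subset n)) → Unique L → All (λ g → ∣ g ∣ ≡ r) L →
    ∑ (n * t) (λ e → 𝟙 (transversalᵇ n e ∧ does (shadow n e ∈? L))) ≡ length L * t ^ r
  #transversals-with-shadow-in n r L L-unique L-uniform = begin
    ∑ (n * t) (λ e → 𝟙 (transversalᵇ n e ∧ does (shadow n e ∈? L)))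
      ≡⟨ ∑-cong (n * t) (λ e → 𝟙-∧-∈? _≟ₛ_ (transversalᵇ n e) (shadow n e) L L-unique) ⟩
    ∑ (n * t) (λ e → sum (map (λ g → 𝟙 (transversalᵇ n e ∧ does (shadow n e ≟ₛ g))) L))
      ≡⟨ ∑-sum-map (n * t) L (λ g e → 𝟙 (transversalᵇ n e ∧ does (shadow n e ≟ₛ g))) ⟩
    sum (map (λ g → ∑ (n * t) (λ e → 𝟙 (transversalᵇ n e ∧ does (shadow n e ≟ₛ g)))) L)
      ≡⟨ sum-uniform L L-uniform ⟩
    length L * t ^ r                                  ∎
    where
    open ≡-Reasoning
    sum-uniform : ∀ L → All (λ g → ∣ g ∣ ≡ r) L →
      sum (map (λ g → ∑ (n * t) (λ e → 𝟙 (transversalᵇ n e ∧ does (shadow n e ≟ₛ g)))) L) ≡ length L * t ^ r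
    sum-uniform [] [] = refl
    sum-uniform (g ∷ L) (∣g∣≡r ∷ rest) =
      cong₂ _+_ (trans (#transversals-with-shadow n g) (cong (t ^_) ∣g∣≡r)) (sum-uniform L rest)

  #crowded : ℕ → ℕ → ℕ
  #crowded n r = ∑ (n * t) (λ e → 𝟙 ((∣ e ∣ ≡ᵇ r) ∧ crowdedᵇ n e))

  [n*t]Cr≡ : ∀ n r → (n * t) C r ≡ (n C r) * t ^ r + #oneDoubles n r + #crowded n r
  [n*t]Cr≡ n r = begin
    (n * t) C r                                    ≡⟨ ∑-size (n * t) r ⟨
    ∑ (n * t) (λ e → 𝟙 (∣ e ∣ ≡ᵇ r))               ≡⟨ ∑-cong (n * t) (λ e → trichotomy (∣ e ∣ ≡ᵇ r) _ _ (oneDouble⇒¬transversal n {e})) ⟩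
    ∑ (n * t) (λ e → 𝟙 ((∣ e ∣ ≡ᵇ r) ∧ transversalᵇ n e) + 𝟙 ((∣ e ∣ ≡ᵇ r) ∧ oneDoubleᵇ n e)
                       + 𝟙 ((∣ e ∣ ≡ᵇ r) ∧ crowdedᵇ n e))
      ≡⟨ ∑-+ (n * t) _ _ ⟩
    ∑ (n * t) (λ e → 𝟙 ((∣ e ∣ ≡ᵇ r) ∧ transversalᵇ n e) + 𝟙 ((∣ e ∣ ≡ᵇ r) ∧ oneDoubleᵇ n e)) + #crowded n r
      ≡⟨ cong (_+ #crowded n r) (∑-+ (n * t) _ _) ⟩
    #transversals n r + #oneDoubles n r + #crowded n r
      ≡⟨ cong (λ z → z + #oneDoubles n r + #crowded n r) (#transversals≡ n r) ⟩
    (n C r) * t ^ r + #oneDoubles n r + #crowded n r ∎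
    where
    open ≡-Reasoning
    trichotomy : ∀ q a s → (T s → ¬ T a) → 𝟙 q ≡ 𝟙 (q ∧ a) + 𝟙 (q ∧ s) + 𝟙 (q ∧ (not a ∧ not s))
    trichotomy false a s _ = refl
    trichotomy true true true s⇒¬a = ⊥-elim (s⇒¬a _ _)
    trichotomy true true false _ = refl
    trichotomy true false true _ = refl
    trichotomy true false false _ = refl

module Construction (t n r : ℕ) .{{_ : NonZero n}} where
  open Blocks t
  open Counting t

  column : Fin (n * t) → Fin n
  column = quotient t

  layer : Fin (n * t) → Fin t
  layer = remainder {n} t

  residue : Subset (n * t) → Fin n
  residue e = Σ∈ (toℕ ∘ column) e mod n

  crowdedWithResidue : Fin n → Subset (n * t) → Bool
  crowdedWithResidue c e = ((∣ e ∣ ≡ᵇ r) ∧ crowdedᵇ n e) ∧ does (residue e Fin.≟ c)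

  ∑-residues : sum (map (λ c → ∑ (n * t) (𝟙 ∘ crowdedWithResidue c)) (allFin n)) ≡ #crowded n r
  ∑-residues = begin
    sum (map (λ c → ∑ (n * t) (𝟙 ∘ crowdedWithResidue c)) (allFin n))
      ≡⟨ ∑-sum-map (n * t) (allFin n) (λ c → 𝟙 ∘ crowdedWithResidue c) ⟨
    ∑ (n * t) (λ e → sum (map (λ c → 𝟙 (crowdedWithResidue c e)) (allFin n)))
      ≡⟨ ∑-cong (n * t) (λ e → trans (sym (𝟙-∧-∈? Fin._≟_ _ (residue e) (allFin n) (Unique.allFin⁺ n)))
           (cong (λ z → 𝟙 (((∣ e ∣ ≡ᵇ r) ∧ crowdedᵇ n e) ∧ z)) (every-residue e))) ⟩
    ∑ (n * t) (λ e → 𝟙 (((∣ e ∣ ≡ᵇ r) ∧ crowdedᵇ n e) ∧ true))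
      ≡⟨ ∑-cong (n * t) (λ e → cong 𝟙 (∧-identityʳ _)) ⟩
    #crowded n r ∎
    where
    open ≡-Reasoning
    every-residue : ∀ e → does (DecMembership._∈?_ Fin._≟_ (residue e) (allFin n)) ≡ true
    every-residue e = Equivalence.to T-≡ (⇒does (DecMembership._∈?_ Fin._≟_ (residue e) (allFin n)) (∈-allFin (residue e)))

  module BlowUp (G : Hypergraph r n) (c : Fin n) where

    keepᵇ : Subset (n * t) → Bool
    keepᵇ e = (transversalᵇ n e ∧ does (shadow n e ∈? edges G)) ∨ crowdedWithResidue c e

    keep⇒∣e∣≡r : ∀ e → T (keepᵇ e) → ∣ e ∣ ≡ r
    keep⇒∣e∣≡r e kept with T-∨⁻ (transversalᵇ n e ∧ does (shadow n e ∈? edges G)) kept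
    ... | inj₁ blown = trans (transversal⇒∣shadow∣ n e (proj₁ blown′))
                             (All.lookup (uniform G) (does⇒ (shadow n e ∈? edges G) (proj₂ blown′)))
      where blown′ = T-∧⁻ (transversalᵇ n e) blown
    ... | inj₂ crowded = ≡ᵇ⇒≡ ∣ e ∣ r (proj₁ (T-∧⁻ (∣ e ∣ ≡ᵇ r) (proj₁ (T-∧⁻ ((∣ e ∣ ≡ᵇ r) ∧ crowdedᵇ n e) crowded))))

    Blown : Subset (n * t) → Set
    Blown e = T (transversalᵇ n e) × shadow n e ∈ edges G

    Crowded : Subset (n * t) → Set
    Crowded e = ¬ T (transversalᵇ n e) × ¬ T (oneDoubleᵇ n e) × residue e ≡ c

    kept⇒blown⊎crowded : ∀ e → T (keepᵇ e) → Blown e ⊎ Crowded e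
    kept⇒blown⊎crowded e kept with T-∨⁻ (transversalᵇ n e ∧ does (shadow n e ∈? edges G)) kept
    ... | inj₁ blown with T-∧⁻ (transversalᵇ n e) blown
    ...   | tr , ∈G = inj₁ (tr , does⇒ (shadow n e ∈? edges G) ∈G)
    kept⇒blown⊎crowded e kept | inj₂ crowded with T-∧⁻ ((∣ e ∣ ≡ᵇ r) ∧ crowdedᵇ n e) crowded
    ... | sized , ≡c with T-∧⁻ (not (transversalᵇ n e)) (proj₂ (T-∧⁻ (∣ e ∣ ≡ᵇ r) sized))
    ...   | ¬tr , ¬od = inj₂ (T-not⁻ _ ¬tr , T-not⁻ _ ¬od , does⇒ (residue e Fin.≟ c) ≡c)

    blowUp : Hypergraph r (n * t)
    blowUp = record
      { edges = filterᵇ keepᵇ (allSubsets (n * t))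
      ; unique = Unique.filter⁺ (T? ∘ keepᵇ) (allSubsets-unique (n * t))
      ; uniform = All.map (λ {e} → keep⇒∣e∣≡r e) (all-filter (T? ∘ keepᵇ) (allSubsets (n * t)))
      }

    ∥blowUp∥ : ∥ blowUp ∥ ≡ ∥ G ∥ * t ^ r + ∑ (n * t) (𝟙 ∘ crowdedWithResidue c)
    ∥blowUp∥ = begin
      length (filterᵇ keepᵇ (allSubsets (n * t)))   ≡⟨ length-filterᵇ-allSubsets (n * t) keepᵇ ⟩
      ∑ (n * t) (𝟙 ∘ keepᵇ)                         ≡⟨ ∑-cong (n * t) (λ e → 𝟙-∨-disjoint _ _ (disjoint e)) ⟩
      ∑ (n * t) (λ e → 𝟙 (transversalᵇ n e ∧ does (shadow n e ∈? edges G)) + 𝟙 (crowdedWithResidue c e))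
        ≡⟨ ∑-+ (n * t) _ _ ⟩
      ∑ (n * t) (λ e → 𝟙 (transversalᵇ n e ∧ does (shadow n e ∈? edges G))) + ∑ (n * t) (𝟙 ∘ crowdedWithResidue c)
        ≡⟨ cong (_+ ∑ (n * t) (𝟙 ∘ crowdedWithResidue c)) (#transversals-with-shadow-in n r (edges G) (unique G) (uniform G)) ⟩
      ∥ G ∥ * t ^ r + ∑ (n * t) (𝟙 ∘ crowdedWithResidue c) ∎
      where
      open ≡-Reasoning
      disjoint : ∀ e → T (transversalᵇ n e ∧ does (shadow n e ∈? edges G)) → ¬ T (crowdedWithResidue c e)
      disjoint e blown crowded = T-not⁻ (transversalᵇ n e)
        (proj₁ (T-∧⁻ (not (transversalᵇ n e)) (proj₂ (T-∧⁻ (∣ e ∣ ≡ᵇ r)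
          (proj₁ (T-∧⁻ ((∣ e ∣ ≡ᵇ r) ∧ crowdedᵇ n e) crowded))))))
        (proj₁ (T-∧⁻ (transversalᵇ n e) blown))

    module Copy {k : ℕ} (f : Fin (suc r) → Fin (n * t)) (f-inj : Injective _≡_ _≡_ f)
      (E : (i : Fin (suc r)) → toℕ i < k → Σ (Subset (n * t)) λ e → e ∈ edges blowUp ×
             ((v : Fin (n * t)) → (v ∈ₛ e) ⇔ (∃ λ j → j ≢ i × f j ≡ v))) where

      edge : ∀ i → toℕ i < k → Subset (n * t)
      edge i i<k = proj₁ (E i i<k)

      ∈edge⁺ : ∀ {i} i<k {j} → j ≢ i → f j ∈ₛ edge i i<k
      ∈edge⁺ {i} i<k {j} j≢i = Equivalence.from (proj₂ (proj₂ (E i i<k)) (f j)) (j , j≢i , refl)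

      ∈edge⁻ : ∀ {i} i<k {w} → w ∈ₛ edge i i<k → ∃ λ j → j ≢ i × f j ≡ w
      ∈edge⁻ {i} i<k {w} = Equivalence.to (proj₂ (proj₂ (E i i<k)) w)

      col : Fin (suc r) → Fin n
      col = column ∘ f

      lay : Fin (suc r) → Fin t
      lay = layer ∘ f

      f≡combine : ∀ j → f j ≡ combine (col j) (lay j)
      f≡combine j = sym (Fin.combine-remQuot {n} t (f j))

      same-position : ∀ {a b} → col a ≡ col b → lay a ≡ lay b → a ≡ b
      same-position {a} {b} ca≡cb la≡lb =
        f-inj (trans (f≡combine a) (trans (cong₂ combine ca≡cb la≡lb) (sym (f≡combine b))))

      ∈block⁺ : ∀ {i} i<k {j} → j ≢ i → lay j ∈ₛ block n (edge i i<k) (col j)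
      ∈block⁺ i<k {j} j≢i = ∈-block⁺ n (col j) (lay j) (subst (_∈ₛ edge _ i<k) (f≡combine j) (∈edge⁺ i<k j≢i))

      ∈block⁻ : ∀ {i} i<k {x ℓ} → ℓ ∈ₛ block n (edge i i<k) x → ∃ λ j → j ≢ i × col j ≡ x × lay j ≡ ℓ
      ∈block⁻ i<k {x} {ℓ} ℓ∈ with ∈edge⁻ i<k (∈-block⁻ n x ℓ ℓ∈)
      ... | j , j≢i , fj≡ = j , j≢i , cong proj₁ position , cong proj₂ position
        where
        position : remQuot {n} t (f j) ≡ (x , ℓ)
        position = trans (cong (remQuot t) fj≡) (Fin.remQuot-combine x ℓ)

      kind : ∀ i i<k → Blown (edge i i<k) ⊎ Crowded (edge i i<k)
      kind i i<k = kept⇒blown⊎crowded (edge i i<k)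
        (proj₂ (∈-filter⁻ (T? ∘ keepᵇ) {xs = allSubsets (n * t)} (proj₁ (proj₂ (E i i<k)))))

      distinct-columns⇒transversal : ∀ {i} i<k → (∀ {a b} → a ≢ i → b ≢ i → col a ≡ col b → a ≡ b) →
        T (transversalᵇ n (edge i i<k))
      distinct-columns⇒transversal i<k distinct =
        ∣block∣≤1⇒transversal n (λ x → ∣p∣≤1 _ (λ ℓ∈ ℓ′∈ → same-layer (∈block⁻ i<k ℓ∈) (∈block⁻ i<k ℓ′∈)))
        where
        same-layer : ∀ {x ℓ ℓ′} → (∃ λ a → a ≢ _ × col a ≡ x × lay a ≡ ℓ) →
          (∃ λ b → b ≢ _ × col b ≡ x × lay b ≡ ℓ′) → ℓ ≡ ℓ′
        same-layer (a , a≢i , ca , la) (b , b≢i , cb , lb) =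
          trans (sym la) (trans (cong lay (distinct a≢i b≢i (trans ca (sym cb)))) lb)

      2≤∣block∣ : ∀ {i} i<k {a b} → a ≢ b → a ≢ i → b ≢ i → col a ≡ col b →
        2 ≤ ∣ block n (edge i i<k) (col a) ∣
      2≤∣block∣ {i} i<k {a} {b} a≢b a≢i b≢i ca≡cb = 2≤∣p∣ (∈block⁺ i<k a≢i)
        (subst (λ x → lay b ∈ₛ block n (edge i i<k) x) (sym ca≡cb) (∈block⁺ i<k b≢i))
        (a≢b ∘ same-position ca≡cb)

      transversal⇒meets-collision : ∀ {i} i<k {a b} → T (transversalᵇ n (edge i i<k)) →
        a ≢ b → col a ≡ col b → i ≡ a ⊎ i ≡ b
      transversal⇒meets-collision {i} i<k {a} {b} tr a≢b ca≡cb with i Fin.≟ a | i Fin.≟ b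
      ... | yes i≡a | _ = inj₁ i≡a
      ... | no _ | yes i≡b = inj₂ i≡b
      ... | no i≢a | no i≢b = ⊥-elim (<⇒≱ (2≤∣block∣ i<k a≢b (i≢a ∘ sym) (i≢b ∘ sym) ca≡cb)
                                        (transversal⇒∣block∣≤1 n tr (col a)))

      single-collision⇒oneDouble : ∀ {i} i<k {a b} → a ≢ b → a ≢ i → b ≢ i → col a ≡ col b →
        (∀ {p q} → p ≢ i → q ≢ i → p ≢ q → col p ≡ col q → p ≡ a ⊎ p ≡ b) →
        T (oneDoubleᵇ n (edge i i<k))
      single-collision⇒oneDouble {i} i<k {a} {b} a≢b a≢i b≢i ca≡cb colliding =
        oneDouble-intro n (col a)
          (∣p∣≡2 (∈block⁺ i<k a≢i) (subst (λ x → lay b ∈ₛ block n (edge i i<k) x) (sym ca≡cb) (∈block⁺ i<k b≢i))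
            (a≢b ∘ same-position ca≡cb) within)
          (λ y y≢ca → ∣p∣≤1 _ (λ ℓ∈ ℓ′∈ → same-layer y≢ca (∈block⁻ i<k ℓ∈) (∈block⁻ i<k ℓ′∈)))
        where
        within : ∀ {ℓ} → ℓ ∈ₛ block n (edge i i<k) (col a) → ℓ ≡ lay a ⊎ ℓ ≡ lay b
        within ℓ∈ with ∈block⁻ i<k ℓ∈
        ... | p , p≢i , cp , refl with p Fin.≟ a
        ...   | yes refl = inj₁ refl
        ...   | no p≢a with colliding p≢i a≢i p≢a cp
        ...     | inj₁ p≡a = ⊥-elim (p≢a p≡a)
        ...     | inj₂ refl = inj₂ refl
        same-layer : ∀ {y ℓ ℓ′} → y ≢ col a → (∃ λ p → p ≢ i × col p ≡ y × lay p ≡ ℓ) →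
          (∃ λ q → q ≢ i × col q ≡ y × lay q ≡ ℓ′) → ℓ ≡ ℓ′
        same-layer {y} y≢ca (p , p≢i , cp , lp) (q , q≢i , cq , lq) with p Fin.≟ q
        ... | yes refl = trans (sym lp) lq
        ... | no p≢q with colliding p≢i q≢i p≢q (trans cp (sym cq))
        ...   | inj₁ refl = ⊥-elim (y≢ca (sym cp))
        ...   | inj₂ refl = ⊥-elim (y≢ca (trans (sym cp) (sym ca≡cb)))

      edge-f⊆ : ∀ {i j} i<k j<k → edge i i<k - f j ⊆ edge j j<k - f i
      edge-f⊆ {i} {j} i<k j<k z∈ with ∈edge⁻ i<k (x∈p-y⇒x∈p z∈)
      ... | l , l≢i , refl = x∈p∧x≢y⇒x∈p-y (∈edge⁺ j<k (λ l≡j → x∈p-y⇒x≢y z∈ (cong f l≡j)))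
                                             (l≢i ∘ f-inj)

      Σ∈-column : Subset (n * t) → ℕ
      Σ∈-column = Σ∈ (toℕ ∘ column)

      Σ∈-column-swap : ∀ {i j} i<k j<k → i ≢ j →
        toℕ (col i) + Σ∈-column (edge i i<k) ≡ toℕ (col j) + Σ∈-column (edge j j<k)
      Σ∈-column-swap {i} {j} i<k j<k i≢j = begin
        toℕ (col i) + Σ∈-column (edge i i<k)
          ≡⟨ cong (toℕ (col i) +_) (x∈p⇒Σ∈p≡g[x]+Σ∈[p-x] _ (∈edge⁺ i<k (i≢j ∘ sym))) ⟩
        toℕ (col i) + (toℕ (col j) + Σ∈-column (edge i i<k - f j))
          ≡⟨ x+[y+z]≡y+[x+z] (toℕ (col i)) (toℕ (col j)) _ ⟩
        toℕ (col j) + (toℕ (col i) + Σ∈-column (edge i i<k - f j))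
          ≡⟨ cong (λ e → toℕ (col j) + (toℕ (col i) + Σ∈-column e)) (⊆-antisym (edge-f⊆ i<k j<k) (edge-f⊆ j<k i<k)) ⟩
        toℕ (col j) + (toℕ (col i) + Σ∈-column (edge j j<k - f i))
          ≡⟨ cong (toℕ (col j) +_) (x∈p⇒Σ∈p≡g[x]+Σ∈[p-x] _ (∈edge⁺ j<k i≢j)) ⟨
        toℕ (col j) + Σ∈-column (edge j j<k) ∎
        where open ≡-Reasoning

      -- Edges i and j of the copy differ only by exchanging f i and f j.
      same-residue⇒same-column : ∀ {i j} i<k j<k → residue (edge i i<k) ≡ c → residue (edge j j<k) ≡ c →
        col i ≡ col j
      same-residue⇒same-column {i} {j} i<k j<k ≡c ≡c′ with i Fin.≟ j
      ... | yes refl = refl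
      ... | no i≢j = Fin.toℕ-injective (mod-cancel n (Fin.toℕ<n (col i)) (Fin.toℕ<n (col j))
          (Σ∈-column-swap i<k j<k i≢j)
          (trans (sym (Fin.toℕ-fromℕ< _)) (trans (cong toℕ (trans ≡c (sym ≡c′))) (Fin.toℕ-fromℕ< _))))

      distinct-columns⇒copy : (∀ {a b} → col a ≡ col b → a ≡ b) → ContainsH k G
      distinct-columns⇒copy distinct = col , distinct , λ i i<k →
        shadow n (edge i i<k) , shadow∈G i<k , λ x → mk⇔ (∈shadow⁻ i<k) (∈shadow⁺ i<k)
        where
        shadow∈G : ∀ {i} i<k → shadow n (edge i i<k) ∈ edges G
        shadow∈G {i} i<k with kind i i<k
        ... | inj₁ (_ , ∈G) = ∈G
        ... | inj₂ (¬tr , _) = ⊥-elim (¬tr (distinct-columns⇒transversal i<k (λ _ _ → distinct)))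
        ∈shadow⁻ : ∀ {i} i<k {x} → x ∈ₛ shadow n (edge i i<k) → ∃ λ j → j ≢ i × col j ≡ x
        ∈shadow⁻ i<k {x} x∈ with ∈-shadow⁻ n x x∈
        ... | ℓ , ℓ∈ with ∈block⁻ i<k ℓ∈
        ...   | j , j≢i , cj , _ = j , j≢i , cj
        ∈shadow⁺ : ∀ {i} i<k {x} → (∃ λ j → j ≢ i × col j ≡ x) → x ∈ₛ shadow n (edge i i<k)
        ∈shadow⁺ i<k (j , j≢i , refl) = ∈-shadow⁺ n (col j) (∈block⁺ i<k j≢i)

      one-column⇒⊥ : k ≤ suc r → t < k → ∀ x → (∀ d → toℕ d < k → col d ≡ x) → ⊥
      one-column⇒⊥ k≤ t<k x in-x with Fin.pigeonhole t<k (λ u → lay (inject≤ u k≤))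
      ... | u , u′ , u<u′ , same-lay = Fin.<-irrefl (Fin.inject≤-injective k≤ k≤ u u′
              (same-position (trans (in-x _ (index<k u)) (sym (in-x _ (index<k u′)))) same-lay)) u<u′
        where
        index<k : ∀ u → toℕ (inject≤ u k≤) < k
        index<k u = subst (_< k) (sym (Fin.toℕ-inject≤ u k≤)) (Fin.toℕ<n u)

      two-crowded⇒⊥ : k ≤ suc r → t < k → ∀ {i d} i<k d<k → i ≢ d →
        residue (edge i i<k) ≡ c → residue (edge d d<k) ≡ c → ⊥
      two-crowded⇒⊥ k≤ t<k {i} {d} i<k d<k i≢d ≡c ≡c′ = one-column⇒⊥ k≤ t<k (col i) in-column-i
        where
        ci≡cd : col i ≡ col d
        ci≡cd = same-residue⇒same-column i<k d<k ≡c ≡c′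
        in-column-i : ∀ d′ d′<k → col d′ ≡ col i
        in-column-i d′ d′<k with kind d′ d′<k
        ... | inj₂ (_ , _ , ≡c″) = same-residue⇒same-column d′<k i<k ≡c″ ≡c
        ... | inj₁ (tr , _) with transversal⇒meets-collision d′<k tr i≢d ci≡cd
        ...   | inj₁ refl = refl
        ...   | inj₂ refl = sym ci≡cd

      -- Given a colliding pair, pick i among the first three vertices outside it: edge i is
      -- crowded. A second crowded edge would put all k vertices in one block; otherwise the two
      -- remaining edges are transversal, so the pair is the only collision and edge i is one-double.
      module _ (k≤1+r : k ≤ suc r) (t<k : t < k) (3≤k : 3 ≤ k) where

        3≤1+r : 3 ≤ suc r
        3≤1+r = ≤-trans 3≤k k≤1+r

        z : Fin 3 → Fin (suc r)
        z u = inject≤ u 3≤1+r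

        z-inj : Injective _≡_ _≡_ z
        z-inj = Fin.inject≤-injective 3≤1+r 3≤1+r _ _

        z<k : ∀ u → toℕ (z u) < k
        z<k u = ≤-trans (subst (_< 3) (sym (Fin.toℕ-inject≤ u 3≤1+r)) (Fin.toℕ<n u)) 3≤k

        crowded-avoider⇒⊥ : ∀ {a b} → a ≢ b → col a ≡ col b → ∀ {u} → z u ≢ a → z u ≢ b →
          Crowded (edge (z u) (z<k u)) → ⊥
        crowded-avoider⇒⊥ {a} {b} a≢b ca≡cb {u} i≢a i≢b (_ , ¬od , ≡c) with the-other-two u
        ... | v , w , v≢w , v≢u , w≢u with kind (z v) (z<k v) | kind (z w) (z<k w)
        ...   | inj₂ (_ , _ , ≡c′) | _ = two-crowded⇒⊥ k≤1+r t<k (z<k u) (z<k v) (v≢u ∘ z-inj ∘ sym) ≡c ≡c′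
        ...   | inj₁ _ | inj₂ (_ , _ , ≡c′) = two-crowded⇒⊥ k≤1+r t<k (z<k u) (z<k w) (w≢u ∘ z-inj ∘ sym) ≡c ≡c′
        ...   | inj₁ (tr₁ , _) | inj₁ (tr₂ , _) =
          ¬od (single-collision⇒oneDouble (z<k u) a≢b (i≢a ∘ sym) (i≢b ∘ sym) ca≡cb colliding)
          where
          colliding : ∀ {p q} → p ≢ z u → q ≢ z u → p ≢ q → col p ≡ col q → p ≡ a ⊎ p ≡ b
          colliding _ _ p≢q cp≡cq
            with pair-⊆ (v≢w ∘ z-inj) (transversal⇒meets-collision (z<k v) tr₁ p≢q cp≡cq)
                                      (transversal⇒meets-collision (z<k w) tr₂ p≢q cp≡cq)
          ... | inj₁ refl = transversal⇒meets-collision (z<k v) tr₁ a≢b ca≡cb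
          ... | inj₂ refl = transversal⇒meets-collision (z<k w) tr₂ a≢b ca≡cb

        collision⇒⊥ : ∀ {a b} → a ≢ b → col a ≡ col b → ⊥
        collision⇒⊥ {a} {b} a≢b ca≡cb with avoid-pair Fin._≟_ z z-inj a b
        ... | u , i≢a , i≢b with kind (z u) (z<k u)
        ...   | inj₂ crowded = crowded-avoider⇒⊥ a≢b ca≡cb i≢a i≢b crowded
        ...   | inj₁ (tr , _) = [ i≢a , i≢b ] (transversal⇒meets-collision (z<k u) tr a≢b ca≡cb)

      collision? : (∀ {a b} → col a ≡ col b → a ≡ b) ⊎ (∃ λ a → ∃ λ b → a ≢ b × col a ≡ col b)
      collision? with Fin.any? (λ a → Fin.any? (λ b → ¬? (a Fin.≟ b) ×-dec (col a Fin.≟ col b)))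
      ... | yes (a , b , a≢b , ca≡cb) = inj₂ (a , b , a≢b , ca≡cb)
      ... | no none = inj₁ distinct
        where
        distinct : ∀ {a b} → col a ≡ col b → a ≡ b
        distinct {a} {b} ca≡cb with a Fin.≟ b
        ... | yes a≡b = a≡b
        ... | no a≢b = ⊥-elim (none (a , b , a≢b , ca≡cb))

    blowUp-free : ∀ {k} → k ≤ suc r → t < k → (∀ (x y : Fin t) → x ≡ y) ⊎ 3 ≤ k →
      HFree k G → HFree k blowUp
    blowUp-free k≤1+r t<k trivial-or-3≤k G-free (f , f-inj , E) with Copy.collision? f f-inj E
    ... | inj₁ distinct = G-free (Copy.distinct-columns⇒copy f f-inj E distinct)
    ... | inj₂ (a , b , a≢b , ca≡cb) with trivial-or-3≤k
    ...   | inj₁ trivial = a≢b (Copy.same-position f f-inj E ca≡cb (trivial _ _))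
    ...   | inj₂ 3≤k = Copy.collision⇒⊥ f f-inj E k≤1+r t<k 3≤k a≢b ca≡cb

  crowded-residue : ∃ λ c → #crowded n r ≤ n * ∑ (n * t) (𝟙 ∘ crowdedWithResidue c)
  crowded-residue with sum-allFin≤n*max n (λ c → ∑ (n * t) (𝟙 ∘ crowdedWithResidue c))
  ... | c , bound = c , subst (_≤ n * ∑ (n * t) (𝟙 ∘ crowdedWithResidue c)) ∑-residues bound

  blowUp-bound : (G : Hypergraph r n) → 1 ≤ t → HFree (suc t) G → suc t ≤ suc r →
    ∃ λ (G′ : Hypergraph r (n * t)) → HFree (suc t) G′ × n * (∥ G ∥ * t ^ r) + #crowded n r ≤ n * ∥ G′ ∥
  blowUp-bound G 1≤t G-free 1+t≤1+r with crowded-residue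
  ... | c , bound = blowUp , blowUp-free 1+t≤1+r ≤-refl (Fin-trivial-or-3≤1+ t 1≤t) G-free , (begin
    n * (∥ G ∥ * t ^ r) + #crowded n r
      ≤⟨ +-monoʳ-≤ (n * (∥ G ∥ * t ^ r)) bound ⟩
    n * (∥ G ∥ * t ^ r) + n * ∑ (n * t) (𝟙 ∘ crowdedWithResidue c)
      ≡⟨ *-distribˡ-+ n _ _ ⟨
    n * (∥ G ∥ * t ^ r + ∑ (n * t) (𝟙 ∘ crowdedWithResidue c))
      ≡⟨ cong (n *_) ∥blowUp∥ ⟨
    n * ∥ blowUp ∥ ∎)
    where
    open BlowUp G c
    open ≤-Reasoning

combine-bounds : ∀ n a p e x s c {y m} → n * (a * p) + c ≤ n * e → m ≡ x * p + s + c → 2 * s ≡ y →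
  2 * n * p * a + 2 * m ≤ 2 * n * e + 2 * p * x + y
combine-bounds n a p e x s c {y} {m} bound m≡ 2s≡y = begin
  2 * n * p * a + 2 * m                        ≡⟨ cong (λ z → 2 * n * p * a + 2 * z) m≡ ⟩
  2 * n * p * a + 2 * (x * p + s + c)          ≡⟨ regroup n a p x s c ⟩
  2 * (n * (a * p) + c) + (2 * p * x + 2 * s)  ≤⟨ +-monoˡ-≤ (2 * p * x + 2 * s) (*-monoʳ-≤ 2 bound) ⟩
  2 * (n * e) + (2 * p * x + 2 * s)            ≡⟨ cong (λ z → 2 * (n * e) + (2 * p * x + z)) 2s≡y ⟩
  2 * (n * e) + (2 * p * x + y)                ≡⟨ regroup′ n e p x y ⟩
  2 * n * e + 2 * p * x + y                    ∎
  where
  open ≤-Reasoning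
  regroup : ∀ n a p x s c → 2 * n * p * a + 2 * (x * p + s + c) ≡ 2 * (n * (a * p) + c) + (2 * p * x + 2 * s)
  regroup = solve-∀
  regroup′ : ∀ n e p x y → 2 * (n * e) + (2 * p * x + y) ≡ 2 * n * e + 2 * p * x + y
  regroup′ = solve-∀

HFree⇒≤ex : ∀ {r k m m′ ex} → IsEx r k m ex → m′ ≡ m → (G : Hypergraph r m′) → HFree k G → ∥ G ∥ ≤ ex
HFree⇒≤ex (_ , maximal) refl = maximal

theorem11 : (r k n exN exTN : ℕ) → 2 ≤ r → 2 ≤ k → k ≤ suc r → 1 ≤ n →
    IsEx r k n exN → IsEx r k ((k ∸ 1) * n) exTN →
    2 * n * ((k ∸ 1) ^ r) * exN + 2 * (((k ∸ 1) * n) C r)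
      ≤ 2 * n * exTN + 2 * ((k ∸ 1) ^ r) * (n C r)
        + n * ((k ∸ 1) ^ (r ∸ 1)) * ((k ∸ 1) ∸ 1) * ((n ∸ 1) C (r ∸ 2))
theorem11 zero _ _ _ _ () _ _ _ _ _
theorem11 (suc zero) _ _ _ _ (s≤s ()) _ _ _ _ _
theorem11 _ zero _ _ _ _ () _ _ _ _
theorem11 _ (suc zero) _ _ _ _ (s≤s ()) _ _ _ _
theorem11 _ _ zero _ _ _ _ _ () _ _
theorem11 (suc (suc r′)) (suc (suc t′)) (suc n′) exN exTN _ _ k≤1+r _ ((G , G-free , ∥G∥≡exN) , _) exTN-ex =
  combine-bounds n exN (t ^ r) exTN (n C r) (#oneDoubles n r) (#crowded n r)
    (exTN-bound (Construction.blowUp-bound t n r G (s≤s z≤n) G-free k≤1+r))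
    (trans (cong (_C r) (*-comm t n)) ([n*t]Cr≡ n r))
    (2*#oneDoubles≡ n r′)
  where
  t = suc t′
  n = suc n′
  r = suc (suc r′)
  open Counting t
  exTN-bound : (∃ λ G′ → HFree (suc t) G′ × n * (∥ G ∥ * t ^ r) + #crowded n r ≤ n * ∥ G′ ∥) →
    n * (exN * t ^ r) + #crowded n r ≤ n * exTN
  exTN-bound (G′ , G′-free , bound) = subst (λ a → n * (a * t ^ r) + #crowded n r ≤ n * exTN) ∥G∥≡exN
    (≤-trans bound (*-monoʳ-≤ n (HFree⇒≤ex exTN-ex (*-comm n t) G′ G′-free)))
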